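{- A graph $G$ with no isolated vertices is $\gamma_{tR}$-ER-supercritical if and only if $G$ is the disjoint union of $m\geq 1$ graphs each of which is either a non-trivial star $K_{1,n}$ ($n\geq1$) or a double star in which each of the two non-pendant vertices has degree at least $3$.
   Context: All graphs are finite and simple. A double star is a tree obtained from two disjoint non-trivial stars by joining their central vertices by an edge (choosing either vertex as centre in the case of $K_2$). A total Roman dominating function (TRD-function) on a graph $G$ with no isolated vertices is a function $f:V(G)\to\{0,1,2\}$ such that every vertex $v$ with $f(v)=0$ is adjacent to some $u$ with $f(u)=2$, and the subgraph induced by $\{w:f(w)>0\}$ has no isolated vertices; its weight is $\sum_v f(v)$ and $\gamma_{tR}(G)$ is the minimum weight. For an edge $e$ incident with a vertex of degree $1$, define $\gamma_{tR}(G-e)=\infty$. A graph $G$ with no isolated vertices is $\gamma_{tR}$-ER-supercritical if $\gamma_{tR}(G-e)\geq\gamma_{tR}(G)+2$ for every edge $e\in E(G)$. -}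

module Defs where

open import Data.Nat using (ℕ; zero; suc; _+_; _≤_; _<_)
open import Data.Fin using (Fin; toℕ; _≟_)
open import Data.Bool using (Bool; true; false; _∧_; _∨_; not; if_then_else_)
open import Data.List using (List; map; allFin)
open import Data.Nat.ListAction using (sum)
open import Data.Product using (Σ; ∃; ∃-syntax; _×_; _,_)
open import Data.Sum using (_⊎_)
open import Relation.Nullary using (¬_; ⌊_⌋)
open import Relation.Binary.PropositionalEquality using (_≡_; _≢_)

Adjacency : ℕ → Set
Adjacency n = Fin n → Fin n → Bool

record Graph : Set where
  field
    n       : ℕ
    adj     : Adjacency n
    sym     : ∀ u v → adj u v ≡ adj v u
    irrefl  : ∀ v → adj v v ≡ false

Adj : ∀ {n} → Adjacency n → Fin n → Fin n → Set
Adj a u v = a u v ≡ true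

deg : ∀ {n} → Adjacency n → Fin n → ℕ
deg {n} a v = sum (map (λ u → if a v u then 1 else 0) (allFin n))

NoIsolated : ∀ {n} → Adjacency n → Set
NoIsolated {n} a = ∀ (v : Fin n) → ∃[ u ] Adj a v u

removeEdge : ∀ {n} → Adjacency n → Fin n → Fin n → Adjacency n
removeEdge a u v x y =
  a x y ∧ not ((⌊ x ≟ u ⌋ ∧ ⌊ y ≟ v ⌋) ∨ (⌊ x ≟ v ⌋ ∧ ⌊ y ≟ u ⌋))

-- Total Roman dominating functions.  A function V → {0,1,2} is
-- represented as Fin n → Fin 3 (value toℕ (f v)).

val : ∀ {n} → (Fin n → Fin 3) → Fin n → ℕ
val f v = toℕ (f v)

weight : ∀ {n} → (Fin n → Fin 3) → ℕ
weight {n} f = sum (map (val f) (allFin n))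

record IsTRDF {n} (a : Adjacency n) (f : Fin n → Fin 3) : Set where
  field
    dom   : ∀ v → val f v ≡ 0 → ∃[ u ] (Adj a v u × val f u ≡ 2)
    -- the subgraph induced by {w : f w > 0} has no isolated vertices
    total : ∀ v → 0 < val f v → ∃[ u ] (Adj a v u × 0 < val f u)

IsγtR : ∀ {n} → Adjacency n → ℕ → Set
IsγtR a k =
  (∃[ f ] (IsTRDF a f × weight f ≡ k)) × (∀ f → IsTRDF a f → k ≤ weight f)

-- γtR-ER-supercritical: γtR(G - e) ≥ γtR(G) + 2 for every edge e.
-- Edges incident with a degree-1 vertex satisfy this trivially
-- (γtR(G - e) = ∞ by convention), so only the other edges impose a condition.
ERSupercritical : Graph → Set
ERSupercritical G =
  ∀ u v → Adj adj u v → deg adj u ≢ 1 → deg adj v ≢ 1 →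
    ∀ k k' → IsγtR adj k → IsγtR (removeEdge adj u v) k' → k + 2 ≤ k'
  where open Graph G

-- A labelling c : V → Fin m splits V into m classes.

InducesStar : ∀ {n m} → Adjacency n → (Fin n → Fin m) → Fin m → Set
InducesStar {n} a c i =
  Σ (Fin n) λ x → c x ≡ i ×
    (∃[ y ] (c y ≡ i × y ≢ x)) ×
    (∀ y → c y ≡ i → y ≢ x → Adj a x y) ×
    (∀ y z → c y ≡ i → c z ≡ i → y ≢ x → z ≢ x → ¬ Adj a y z)

InducesDoubleStar3 : ∀ {n m} → Adjacency n → (Fin n → Fin m) → Fin m → Set
InducesDoubleStar3 {n} a c i =
  Σ (Fin n) λ x → Σ (Fin n) λ y →
    c x ≡ i × c y ≡ i × x ≢ y × Adj a x y ×
    (∀ z → c z ≡ i → z ≢ x → z ≢ y →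
       (Adj a x z × ¬ Adj a y z) ⊎ (Adj a y z × ¬ Adj a x z)) ×
    (∀ z w → c z ≡ i → c w ≡ i → z ≢ x → z ≢ y → w ≢ x → w ≢ y → ¬ Adj a z w) ×
    3 ≤ deg a x × 3 ≤ deg a y

UnionOfStarsAndDoubleStars : Graph → Set
UnionOfStarsAndDoubleStars G =
  Σ ℕ λ m → 1 ≤ m × Σ (Fin n → Fin m) λ c →
    (∀ u v → Adj adj u v → c u ≡ c v) ×
    (∀ i → InducesStar adj c i ⊎ InducesDoubleStar3 adj c i)
  where open Graph G

-- Call an edge inner if neither end is a leaf.
--
-- (⇐) In a disjoint union of stars and of double stars with centres of degree ≥ 3, the only
-- inner edges are the central edges xy of the double stars. In a TRD-function of G − xy, the
-- vertex x and two of its pendant neighbours carry weight ≥ 3, and so do y and two of its own;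
-- giving x and y the value 2 and those four leaves the value 0 yields a TRD-function of G that
-- is lighter by at least 2.
--
-- (⇒) Fix a γtR(G)-function f and an inner edge uv. Supercriticality forbids TRD-functions of
-- G − uv of weight γtR(G) + 1, which rules out every small modification of f that would give
-- one. This forces f(u) = f(v) = 2, all other neighbours of u and v to be leaves, and
-- deg u, deg v ≥ 3. So every non-leaf has at most one non-leaf neighbour, and grouping the
-- vertices by the centres they hang from splits G into stars and double stars.

module Submission where

open import Defs
open import Data.Bool using (Bool; true; false; _∧_; not; if_then_else_)
open import Data.Bool.Properties using (∧-identityʳ; ∧-zeroʳ; ∨-zeroʳ) renaming (_≟_ to _≟ᵇ_)
open import Data.Empty using (⊥; ⊥-elim)
open import Data.Fin using (Fin; zero; suc; _≟_; toℕ; #_; fromℕ<)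
open import Data.Fin.Properties using (suc-injective; any?; all?; toℕ<n)
open import Data.Fin.Subset using (Subset; ⁅_⁆; _∪_) renaming (_∈_ to _∈ₛ_)
open import Data.Fin.Subset.Properties using (x∈⁅x⁆; x∈⁅y⁆⇒x≡y; x∈p∪q⁺; x∈p∪q⁻; ∪-comm)
open import Data.List using (List; allFin; tabulate; map; length; lookup; deduplicate)
open import Data.List.Membership.Propositional using (_∈_)
open import Data.List.Membership.Propositional.Properties
  using (∈-lookup; ∈-allFin; ∈-map⁺; ∈-map⁻; ∈-deduplicate⁺; ∈-deduplicate⁻)
open import Data.List.Properties using (tabulate-cong; map-tabulate; map-cong)
import Data.List.Relation.Unary.All as All
open import Data.List.Relation.Unary.AllPairs using (_∷_)
open import Data.List.Relation.Unary.Any using (index)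
open import Data.List.Relation.Unary.Any.Properties using (lookup-index)
open import Data.List.Relation.Unary.Unique.Propositional using (Unique)
open import Data.List.Relation.Unary.Unique.DecPropositional.Properties using (deduplicate-!)
open import Data.Nat using (ℕ; zero; suc; _+_; _≤_; _<_; z≤n; s≤s)
open import Data.Nat.Induction using (<-rec)
open import Data.Nat.ListAction using (sum)
open import Data.Nat.Properties
  using (<⇒≢; ≮⇒≥; anyUpTo?; +-assoc; +-comm; m+n≡0⇒m≡0; m+n≡0⇒n≡0; +-identityʳ; ≤-pred; ≤-trans)
import Data.Nat.Properties as ℕ
open import Data.Nat.Tactic.RingSolver using (solve-∀)
open import Data.Product using (∃; ∃-syntax; _×_; _,_; proj₁; proj₂)
import Data.Product as Prod
open import Data.Sum using (_⊎_; inj₁; inj₂; [_,_])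
import Data.Sum as Sum
open import Data.Vec.Functional using (updateAt; head; tail) renaming (_∷_ to _◂_)
open import Data.Vec.Functional.Properties using (updateAt-updates; updateAt-minimal)
open import Data.Vec.Properties using (≡-dec)
open import Function using (_∘_; id; const; case_of_)
open import Function.Bundles using (_⇔_; mk⇔)
open import Relation.Binary.Definitions using (DecidableEquality)
open import Relation.Binary.PropositionalEquality
  using (_≡_; _≢_; refl; sym; trans; cong; cong₂; subst; _≗_; module ≡-Reasoning)
open import Relation.Nullary using (¬_; ¬?; Dec; yes; no; ⌊_⌋)
open import Relation.Nullary.Decidable
  using (dec-true; dec-false; isYes≗does; decidable-stable; map′; _×-dec_; _→-dec_; _⊎-dec_)
open import Relation.Unary using (Decidable)

∑ : ∀ {n} → (Fin n → ℕ) → ℕ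
∑ F = sum (tabulate F)

∑-cong : ∀ {n} {F G : Fin n → ℕ} → F ≗ G → ∑ F ≡ ∑ G
∑-cong = cong sum ∘ tabulate-cong

∑-update : ∀ {n} {F G : Fin n → ℕ} x → (∀ v → v ≢ x → F v ≡ G v) → ∑ F + G x ≡ ∑ G + F x
∑-update {suc n} {F} {G} zero agree = begin
    F zero + ∑ (F ∘ suc) + G zero   ≡⟨ cong (λ s → F zero + s + G zero) (∑-cong (λ v → agree (suc v) λ ())) ⟩
    F zero + ∑ (G ∘ suc) + G zero   ≡⟨ +-assoc (F zero) _ _ ⟩
    F zero + (∑ (G ∘ suc) + G zero) ≡⟨ +-comm (F zero) _ ⟩
    ∑ (G ∘ suc) + G zero + F zero   ≡⟨ cong (_+ F zero) (+-comm (∑ (G ∘ suc)) (G zero)) ⟩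
    G zero + ∑ (G ∘ suc) + F zero   ∎
  where open ≡-Reasoning
∑-update {suc n} {F} {G} (suc x) agree = begin
    F zero + ∑ (F ∘ suc) + G (suc x)   ≡⟨ +-assoc (F zero) _ _ ⟩
    F zero + (∑ (F ∘ suc) + G (suc x)) ≡⟨ cong₂ _+_ (agree zero λ ()) (∑-update x agree-tail) ⟩
    G zero + (∑ (G ∘ suc) + F (suc x)) ≡⟨ +-assoc (G zero) _ _ ⟨
    G zero + ∑ (G ∘ suc) + F (suc x)   ∎
  where
  open ≡-Reasoning
  agree-tail : ∀ v → v ≢ x → F (suc v) ≡ G (suc v)
  agree-tail v v≢x = agree (suc v) (v≢x ∘ suc-injective)

∑≡0⇒≡0 : ∀ {n} {F : Fin n → ℕ} → ∑ F ≡ 0 → ∀ v → F v ≡ 0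
∑≡0⇒≡0 {suc n} {F} s zero    = m+n≡0⇒m≡0 (F zero) s
∑≡0⇒≡0 {suc n} {F} s (suc v) = ∑≡0⇒≡0 (m+n≡0⇒n≡0 (F zero) s) v

≡0⇒∑≡0 : ∀ {n} {F : Fin n → ℕ} → (∀ v → F v ≡ 0) → ∑ F ≡ 0
≡0⇒∑≡0 {zero}  z = refl
≡0⇒∑≡0 {suc n} z = cong₂ _+_ (z zero) (≡0⇒∑≡0 (z ∘ suc))

∑>0⇒>0 : ∀ {n} {F : Fin n → ℕ} → 0 < ∑ F → ∃[ v ] 0 < F v
∑>0⇒>0 {suc n} {F} s with F zero in eq
... | suc _ = zero , subst (0 <_) (sym eq) (s≤s z≤n)
... | zero  with ∑>0⇒>0 s
...   | v , p = suc v , p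

indicator : Bool → ℕ
indicator b = if b then 1 else 0

count : ∀ {n} → (Fin n → Bool) → ℕ
count p = ∑ (indicator ∘ p)

⌊≟⌋-refl : ∀ {n} (v : Fin n) → ⌊ v ≟ v ⌋ ≡ true
⌊≟⌋-refl v = trans (isYes≗does (v ≟ v)) (dec-true (v ≟ v) refl)

⌊≟⌋-≢ : ∀ {n} {v y : Fin n} → v ≢ y → ⌊ v ≟ y ⌋ ≡ false
⌊≟⌋-≢ {v = v} {y} v≢y = trans (isYes≗does (v ≟ y)) (dec-false (v ≟ y) v≢y)

⌊≟⌋∧⌊≟⌋-false : ∀ {n} {p q x y : Fin n} → ¬ (p ≡ x × q ≡ y) → ⌊ p ≟ x ⌋ ∧ ⌊ q ≟ y ⌋ ≡ false
⌊≟⌋∧⌊≟⌋-false {p = p} {q} {x} {y} ¬xy with p ≟ x | q ≟ y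
... | yes p≡x | yes q≡y = ⊥-elim (¬xy (p≡x , q≡y))
... | yes _   | no _    = refl
... | no _    | _       = refl

_─_ : ∀ {n} → (Fin n → Bool) → Fin n → (Fin n → Bool)
(p ─ y) v = p v ∧ not ⌊ v ≟ y ⌋

─-intro : ∀ {n} (p : Fin n → Bool) {y v} → p v ≡ true → v ≢ y → (p ─ y) v ≡ true
─-intro p {y} {v} pv v≢y rewrite pv | ⌊≟⌋-≢ v≢y = refl

─-elim : ∀ {n} (p : Fin n → Bool) {y v} → (p ─ y) v ≡ true → p v ≡ true × v ≢ y
─-elim p {y} {v} h with p v | v ≟ y
... | true  | no v≢y = refl , v≢y
... | true  | yes _  = ⊥-elim (case h of λ ())
... | false | _      = ⊥-elim (case h of λ ())

count-─ : ∀ {n} (p : Fin n → Bool) {y} → p y ≡ true → count p ≡ suc (count (p ─ y))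
count-─ p {y} py = begin
    count p                         ≡⟨ +-identityʳ (count p) ⟨
    count p + 0                     ≡⟨ cong (count p +_) y-removed ⟨
    count p + indicator ((p ─ y) y) ≡⟨ ∑-update y agree ⟩
    count (p ─ y) + indicator (p y) ≡⟨ cong (λ b → count (p ─ y) + indicator b) py ⟩
    count (p ─ y) + 1               ≡⟨ +-comm (count (p ─ y)) 1 ⟩
    suc (count (p ─ y))             ∎
  where
  open ≡-Reasoning
  y-removed : indicator ((p ─ y) y) ≡ 0
  y-removed rewrite ⌊≟⌋-refl y | ∧-zeroʳ (p y) = refl
  agree : ∀ v → v ≢ y → indicator (p v) ≡ indicator ((p ─ y) v)
  agree v v≢y rewrite ⌊≟⌋-≢ v≢y | ∧-identityʳ (p v) = refl

count≡0⇒¬ : ∀ {n} (p : Fin n → Bool) → count p ≡ 0 → ∀ v → p v ≢ true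
count≡0⇒¬ p c v pv = case subst (λ b → indicator b ≡ 0) pv (∑≡0⇒≡0 c v) of λ ()

¬⇒count≡0 : ∀ {n} (p : Fin n → Bool) → (∀ v → p v ≢ true) → count p ≡ 0
¬⇒count≡0 p none = ≡0⇒∑≡0 zero-at
  where
  zero-at : ∀ v → indicator (p v) ≡ 0
  zero-at v with p v in eq
  ... | true  = ⊥-elim (none v eq)
  ... | false = refl

count>0⇒∃ : ∀ {n} (p : Fin n → Bool) → 0 < count p → ∃[ v ] p v ≡ true
count>0⇒∃ p c with ∑>0⇒>0 c
... | v , pos with p v in eq
...   | true = v , eq

Leaf : ∀ {n} → Adjacency n → Fin n → Set
Leaf a x = deg a x ≡ 1

leaf? : ∀ {n} (a : Adjacency n) x → Dec (Leaf a x)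
leaf? a x = deg a x ℕ.≟ 1

module _ {n} (a : Adjacency n) where

  deg≡count : ∀ x → deg a x ≡ count (a x)
  deg≡count x = cong sum (map-tabulate id (indicator ∘ a x))

  deg-─ : ∀ {x y} → Adj a x y → deg a x ≡ suc (count (a x ─ y))
  deg-─ {x} xy = trans (deg≡count x) (count-─ (a x) xy)

  leaf-unique : ∀ {x y z} → Leaf a x → Adj a x y → Adj a x z → z ≡ y
  leaf-unique {x} {y} {z} d xy xz with z ≟ y
  ... | yes z≡y = z≡y
  ... | no z≢y  = ⊥-elim (count≡0⇒¬ (a x ─ y) (ℕ.suc-injective (trans (sym (deg-─ xy)) d)) z (─-intro (a x) xz z≢y))

  leaf-intro : ∀ {x y} → Adj a x y → (∀ z → Adj a x z → z ≡ y) → Leaf a x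
  leaf-intro {x} {y} xy only = trans (deg-─ xy) (cong suc (¬⇒count≡0 (a x ─ y) none-other))
    where
    none-other : ∀ z → (a x ─ y) z ≢ true
    none-other z h = let (xz , z≢y) = ─-elim (a x) h in z≢y (only z xz)

  another-neighbour : ∀ {x y} → ¬ Leaf a x → Adj a x y → ∃[ z ] (Adj a x z × z ≢ y)
  another-neighbour {x} {y} ¬leaf xy
    with count>0⇒∃ (a x ─ y) (ℕ.n≢0⇒n>0 λ none → ¬leaf (trans (deg-─ xy) (cong suc none)))
  ... | z , h = z , ─-elim (a x) h

  others≥2 : ∀ {x y} → 3 ≤ deg a x → Adj a x y → 2 ≤ count (a x ─ y)
  others≥2 d xy = ≤-pred (subst (3 ≤_) (deg-─ xy) d)

  two-other-neighbours : ∀ {x y} → 3 ≤ deg a x → Adj a x y →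
    ∃[ z₁ ] ∃[ z₂ ] (Adj a x z₁ × Adj a x z₂ × z₁ ≢ y × z₂ ≢ y × z₁ ≢ z₂)
  two-other-neighbours {x} {y} d xy with count>0⇒∃ (a x ─ y) (≤-trans (s≤s z≤n) (others≥2 d xy))
  ... | z₁ , h₁ with count>0⇒∃ ((a x ─ y) ─ z₁) (≤-pred (subst (2 ≤_) (count-─ (a x ─ y) h₁) (others≥2 d xy)))
  ...   | z₂ , h₂ with ─-elim (a x ─ y) h₂
  ...     | h₂′ , z₂≢z₁ with ─-elim (a x) h₁ | ─-elim (a x) h₂′
  ...       | xz₁ , z₁≢y | xz₂ , z₂≢y = z₁ , z₂ , xz₁ , xz₂ , z₁≢y , z₂≢y , z₂≢z₁ ∘ sym

  deg≤2⇒neighbours : ∀ {x y z w} → deg a x ≤ 2 → Adj a x y → Adj a x z → z ≢ y → Adj a x w → w ≡ y ⊎ w ≡ z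
  deg≤2⇒neighbours {x} {y} {z} {w} d xy xz z≢y xw with w ≟ y | w ≟ z
  ... | yes w≡y | _       = inj₁ w≡y
  ... | no _    | yes w≡z = inj₂ w≡z
  ... | no w≢y  | no w≢z  =
    ⊥-elim (count≡0⇒¬ ((a x ─ y) ─ z) rest-empty w (─-intro (a x ─ y) (─-intro (a x) xw w≢y) w≢z))
    where
    deg≡2+rest : deg a x ≡ 2 + count ((a x ─ y) ─ z)
    deg≡2+rest = trans (deg-─ xy) (cong suc (count-─ (a x ─ y) (─-intro (a x) xz z≢y)))
    rest-empty : count ((a x ─ y) ─ z) ≡ 0
    rest-empty = ℕ.n≤0⇒n≡0 (ℕ.+-cancelˡ-≤ 2 _ 0 (subst (_≤ 2) deg≡2+rest d))

Adj-sym : (G : Graph) → ∀ {u v} → Adj (Graph.adj G) u v → Adj (Graph.adj G) v u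
Adj-sym G {u} {v} uv = trans (Graph.sym G v u) uv

Adj⇒≢ : (G : Graph) → ∀ {u v} → Adj (Graph.adj G) u v → u ≢ v
Adj⇒≢ G {u} uv refl = case trans (sym uv) (Graph.irrefl G u) of λ ()

module _ {n} (a : Adjacency n) (u v : Fin n) where

  removeEdge-⊆ : ∀ {p q} → Adj (removeEdge a u v) p q → Adj a p q
  removeEdge-⊆ {p} {q} h with a p q
  ... | true  = refl
  ... | false = h

  removeEdge-keeps : ∀ {p q} → Adj a p q → ¬ (p ≡ u × q ≡ v) → ¬ (p ≡ v × q ≡ u) → Adj (removeEdge a u v) p q
  removeEdge-keeps pq ¬uv ¬vu rewrite pq | ⌊≟⌋∧⌊≟⌋-false ¬uv | ⌊≟⌋∧⌊≟⌋-false ¬vu = refl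

  removeEdge-removes : ∀ {p q} → (p ≡ u × q ≡ v) ⊎ (p ≡ v × q ≡ u) → ¬ Adj (removeEdge a u v) p q
  removeEdge-removes {p} {q} ends h = case trans (sym (gone ends)) h of λ ()
    where
    gone : (p ≡ u × q ≡ v) ⊎ (p ≡ v × q ≡ u) → removeEdge a u v p q ≡ false
    gone (inj₁ (refl , refl)) rewrite ⌊≟⌋-refl u | ⌊≟⌋-refl v = ∧-zeroʳ (a u v)
    gone (inj₂ (refl , refl)) rewrite ⌊≟⌋-refl u | ⌊≟⌋-refl v | ∨-zeroʳ (⌊ v ≟ u ⌋ ∧ ⌊ u ≟ v ⌋) =
      ∧-zeroʳ (a v u)

record TRDAt {n} (a : Adjacency n) (f : Fin n → Fin 3) (p : Fin n) : Set where
  field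
    dominated : val f p ≡ 0 → ∃[ q ] (Adj a p q × val f q ≡ 2)
    supported : 0 < val f p → ∃[ q ] (Adj a p q × 0 < val f q)

module _ {n} {a : Adjacency n} {f : Fin n → Fin 3} where

  IsTRDF⇒TRDAt : IsTRDF a f → ∀ p → TRDAt a f p
  IsTRDF⇒TRDAt t p = record { dominated = IsTRDF.dom t p ; supported = IsTRDF.total t p }

  TRDAt⇒IsTRDF : (∀ p → TRDAt a f p) → IsTRDF a f
  TRDAt⇒IsTRDF t = record { dom = TRDAt.dominated ∘ t ; total = TRDAt.supported ∘ t }

>0-of : ∀ {m c} → m ≡ suc c → 0 < m
>0-of refl = s≤s z≤n

module _ {n} {b : Adjacency n} {g : Fin n → Fin 3} {p q : Fin n} where

  TRDAt-paired : 0 < val g p → Adj b p q → 0 < val g q → TRDAt b g p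
  TRDAt-paired gp pq gq = record
    { dominated = λ gp≡0 → ⊥-elim (<⇒≢ gp (sym gp≡0))
    ; supported = λ _ → q , pq , gq }

  TRDAt-dominated : val g p ≡ 0 → Adj b p q → val g q ≡ 2 → TRDAt b g p
  TRDAt-dominated gp pq gq = record
    { dominated = λ _ → q , pq , gq
    ; supported = λ gp>0 → ⊥-elim (<⇒≢ gp>0 (sym gp)) }

TRDAt-transfer : ∀ {n} {a b : Adjacency n} {f g : Fin n → Fin 3} {p} → TRDAt a f p → val g p ≡ val f p →
  (∀ {q} → Adj a p q → 0 < val f q → Adj b p q × (val g q ≡ val f q ⊎ val g q ≡ 2)) → TRDAt b g p
TRDAt-transfer {f = f} {g} t gp≡fp keep = record
  { dominated = λ gp≡0 →
      let (q , pq , fq≡2) = TRDAt.dominated t (trans (sym gp≡fp) gp≡0)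
          (pq′ , gq)      = keep pq (>0-of fq≡2)
      in q , pq′ , [ (λ gq≡fq → trans gq≡fq fq≡2) , id ] gq
  ; supported = λ gp>0 →
      let (q , pq , fq>0) = TRDAt.supported t (subst (0 <_) gp≡fp gp>0)
          (pq′ , gq)      = keep pq fq>0
      in q , pq′ , [ (λ gq≡fq → subst (0 <_) (sym gq≡fq) fq>0) , >0-of ] gq }

_[_≔_] : ∀ {n} → (Fin n → Fin 3) → Fin n → Fin 3 → Fin n → Fin 3
f [ x ≔ c ] = updateAt f x (const c)

module _ {n} (f : Fin n → Fin 3) (x : Fin n) (c : Fin 3) where

  ≔-same : val (f [ x ≔ c ]) x ≡ toℕ c
  ≔-same = cong toℕ (updateAt-updates x f)

  ≔-other : ∀ {p} → p ≢ x → val (f [ x ≔ c ]) p ≡ val f p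
  ≔-other {p} p≢x = cong toℕ (updateAt-minimal p x f p≢x)

  weight-≔ : weight (f [ x ≔ c ]) + val f x ≡ weight f + toℕ c
  weight-≔ = begin
    weight (f [ x ≔ c ]) + val f x ≡⟨ cong (_+ val f x) (weight≡∑ (f [ x ≔ c ])) ⟩
    ∑ (val (f [ x ≔ c ])) + val f x ≡⟨ ∑-update x (λ p → ≔-other) ⟩
    ∑ (val f) + val (f [ x ≔ c ]) x ≡⟨ cong₂ _+_ (weight≡∑ f) (sym ≔-same) ⟨
    weight f + toℕ c                ∎
    where
    open ≡-Reasoning
    weight≡∑ : ∀ g → weight g ≡ ∑ (val g)
    weight≡∑ g = cong sum (map-tabulate id (val g))

  weight-raise : val f x ≡ 0 → weight (f [ x ≔ c ]) ≡ weight f + toℕ c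
  weight-raise fx≡0 = trans (sym (+-identityʳ _)) (trans (cong (weight (f [ x ≔ c ]) +_) (sym fx≡0)) weight-≔)

-- Existence of γtR

TRDF? : ∀ {n} (a : Adjacency n) f → Dec (IsTRDF a f)
TRDF? a f = map′ (λ (d , t) → record { dom = d ; total = t }) (λ t → IsTRDF.dom t , IsTRDF.total t)
  (  all? (λ v → val f v ℕ.≟ 0 →-dec any? λ u → (a v u ≟ᵇ true) ×-dec (val f u ℕ.≟ 2))
  ×-dec all? (λ v → 0 ℕ.<? val f v →-dec any? λ u → (a v u ≟ᵇ true) ×-dec (0 ℕ.<? val f u)))

IsTRDF-resp-≗ : ∀ {n} {a : Adjacency n} {f g} → f ≗ g → IsTRDF a f → IsTRDF a g
IsTRDF-resp-≗ {a = a} {f} {g} f≗g t = TRDAt⇒IsTRDF λ p →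
  TRDAt-transfer (IsTRDF⇒TRDAt t p) (val≗ p) λ {q} pq _ → pq , inj₁ (val≗ q)
  where
  val≗ : ∀ p → val g p ≡ val f p
  val≗ p = cong toℕ (sym (f≗g p))

◂-cong : ∀ {n} {A : Set} (c : A) {f g : Fin n → A} → f ≗ g → (c ◂ f) ≗ (c ◂ g)
◂-cong c f≗g zero    = refl
◂-cong c f≗g (suc i) = f≗g i

head◂tail : ∀ {n} {A : Set} (f : Fin (suc n) → A) → f ≗ (head f ◂ tail f)
head◂tail f zero    = refl
head◂tail f (suc i) = refl

any-function? : ∀ n {k} (Q : (Fin n → Fin k) → Set) → (∀ f → Dec (Q f)) → (∀ {f g} → f ≗ g → Q f → Q g) →
  Dec (∃ Q)
any-function? zero Q Q? resp with Q? (λ ())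
... | yes q = yes (_ , q)
... | no ¬q = no λ (f , qf) → ¬q (resp (λ ()) qf)
any-function? (suc n) Q Q? resp with any? (λ c → any-function? n (Q ∘ (c ◂_)) (Q? ∘ (c ◂_)) (resp ∘ ◂-cong c))
... | yes (c , f , q) = yes (c ◂ f , q)
... | no ¬q = no λ (f , qf) → ¬q (head f , tail f , resp (head◂tail f) qf)

Least : (ℕ → Set) → Set
Least P = ∃[ k ] (P k × ∀ {j} → P j → k ≤ j)

least : ∀ {P : ℕ → Set} → Decidable P → ∀ {w} → P w → Least P
least {P} P? {w} = <-rec (λ w → P w → Least P) step w
  where
  step : ∀ w → (∀ {v} → v < w → P v → Least P) → P w → Least P
  step w below pw with anyUpTo? P? w
  ... | yes (v , v<w , pv) = below v<w pv
  ... | no none            = w , pw , λ pj → ≮⇒≥ λ j<w → none (_ , j<w , pj)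

γtR-exists : ∀ {n} (a : Adjacency n) {f} → IsTRDF a f → ∃[ k ] IsγtR a k
γtR-exists a t =
  let (k , optimum , minimal) = least (λ w → any-function? _ _ (λ g → TRDF? a g ×-dec (weight g ℕ.≟ w)) resp) (_ , t , refl)
  in k , optimum , λ g tg → minimal (g , tg , refl)
  where
  resp : ∀ {w f g} → f ≗ g → IsTRDF a f × weight f ≡ w → IsTRDF a g × weight g ≡ w
  resp f≗g (t , wf) = IsTRDF-resp-≗ f≗g t , trans (sym (cong sum (map-cong (cong toℕ ∘ f≗g) (allFin _)))) wf

support-positive : ∀ {n} {a : Adjacency n} {f} → IsTRDF a f → ∀ {x w} → Leaf a x → Adj a x w → 0 < val f w
support-positive {a = a} {f} t {x} {w} leaf xw with val f x ℕ.≟ 0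
... | yes fx≡0 =
  let (q , xq , fq≡2) = IsTRDF.dom t x fx≡0
  in subst (λ q → 0 < val f q) (leaf-unique a leaf xw xq) (>0-of fq≡2)
... | no fx≢0 =
  let (q , xq , fq>0) = IsTRDF.total t x (ℕ.n≢0⇒n>0 fx≢0)
  in subst (λ q → 0 < val f q) (leaf-unique a leaf xw xq) fq>0

-- Inner edges of a supercritical graph

InnerEdgesAreCentral : Graph → Set
InnerEdgesAreCentral G = ∀ {u v} → Adj adj u v → ¬ Leaf adj u → ¬ Leaf adj v →
  (∀ {w} → Adj adj u w → w ≢ v → Leaf adj w) × 3 ≤ deg adj u
  where open Graph G

module Supercritical (G : Graph) (sc : ERSupercritical G) {k} (γ : IsγtR (Graph.adj G) k) where

  open Graph G using (n; adj)

  -- f is a γtR(G)-function. Each fact below holds because otherwise a small change of f would be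
  -- a TRD-function of G − uv of weight at most γtR(G) + 1, which no-cheap-removal forbids.

  private
    f : Fin n → Fin 3
    f = proj₁ (proj₁ γ)

    f-TRDF : IsTRDF adj f
    f-TRDF = proj₁ (proj₂ (proj₁ γ))

    f-weight : weight f ≡ k
    f-weight = proj₂ (proj₂ (proj₁ γ))

    keep : ∀ {u v p q} → Adj adj p q → (p ≢ u ⊎ q ≢ v) → (p ≢ v ⊎ q ≢ u) → Adj (removeEdge adj u v) p q
    keep {u} {v} pq off₁ off₂ = removeEdge-keeps adj u v pq
      (λ (p≡u , q≡v) → [ (λ ne → ne p≡u) , (λ ne → ne q≡v) ] off₁)
      (λ (p≡v , q≡u) → [ (λ ne → ne p≡v) , (λ ne → ne q≡u) ] off₂)

    zero≢pos : ∀ {g : Fin n → Fin 3} {x y} → val g x ≡ 0 → 0 < val g y → y ≢ x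
    zero≢pos gx gy refl = <⇒≢ gy (sym gx)

    f-light : weight f ≤ k + 1
    f-light = subst (_≤ k + 1) (sym f-weight) (ℕ.m≤m+n k 1)

    raise-light : ∀ x → val f x ≡ 0 → weight (f [ x ≔ # 1 ]) ≤ k + 1
    raise-light x fx≡0 = ℕ.≤-reflexive (trans (weight-raise f x (# 1) fx≡0) (cong (_+ 1) f-weight))

    transfer : ∀ {u v g p} → val g p ≡ val f p →
      (∀ {q} → Adj adj p q → 0 < val f q → (p ≢ u ⊎ q ≢ v) × (p ≢ v ⊎ q ≢ u) × val g q ≡ val f q) →
      TRDAt (removeEdge adj u v) g p
    transfer {p = p} gp≡fp ok = TRDAt-transfer (IsTRDF⇒TRDAt f-TRDF p) gp≡fp λ pq fq>0 →
      let (off₁ , off₂ , gq≡fq) = ok pq fq>0 in keep pq off₁ off₂ , inj₁ gq≡fq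

  no-cheap-removal : ∀ {u v g} → Adj adj u v → ¬ Leaf adj u → ¬ Leaf adj v →
    (∀ p → TRDAt (removeEdge adj u v) g p) → weight g ≤ k + 1 → ⊥
  no-cheap-removal {u} {v} {g} uv ¬lu ¬lv at light with γtR-exists _ (TRDAt⇒IsTRDF at)
  ... | k′ , γ′ =
    let k+2≤k′ = sc u v uv ¬lu ¬lv k k′ γ γ′
        k′≤k+1 = ≤-trans (proj₂ γ′ g (TRDAt⇒IsTRDF at)) light
    in case ℕ.+-cancelˡ-≤ k 2 1 (≤-trans k+2≤k′ k′≤k+1) of λ { (s≤s ()) }

  ¬inner-ends-zero : ∀ {u v} → Adj adj u v → ¬ Leaf adj u → ¬ Leaf adj v → val f u ≡ 0 → val f v ≡ 0 → ⊥
  ¬inner-ends-zero uv ¬lu ¬lv fu≡0 fv≡0 = no-cheap-removal uv ¬lu ¬lv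
    (λ p → transfer refl λ _ fq>0 → inj₂ (zero≢pos fv≡0 fq>0) , inj₂ (zero≢pos fu≡0 fq>0) , refl) f-light

  inner-end-positive : ∀ {u v} → Adj adj u v → ¬ Leaf adj u → ¬ Leaf adj v → 0 < val f u
  inner-end-positive {u} {v} uv ¬lu ¬lv with val f u ℕ.≟ 0
  ... | no fu≢0 = ℕ.n≢0⇒n>0 fu≢0
  ... | yes fu≡0 with another-neighbour adj ¬lu uv
  ...   | w , uw , w≢v = ⊥-elim (no-cheap-removal uv ¬lu ¬lv at (raise-light u fu≡0))
    where
    fw>0 : 0 < val f w
    fw>0 with leaf? adj w
    ... | yes lw  = ⊥-elim (<⇒≢ (support-positive f-TRDF lw (Adj-sym G uw)) (sym fu≡0))
    ... | no ¬lw  = ℕ.n≢0⇒n>0 (¬inner-ends-zero uw ¬lu ¬lw fu≡0)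

    at : ∀ p → TRDAt (removeEdge adj u v) (f [ u ≔ # 1 ]) p
    at p with p ≟ u
    ... | yes refl = TRDAt-paired (>0-of (≔-same f u (# 1))) (keep uw (inj₂ w≢v) (inj₁ (Adj⇒≢ G uv)))
                       (subst (0 <_) (sym (≔-other f u (# 1) (Adj⇒≢ G uw ∘ sym))) fw>0)
    ... | no p≢u   = transfer (≔-other f u (# 1) p≢u) λ _ fq>0 →
                       inj₁ p≢u , inj₂ (zero≢pos fu≡0 fq>0) , ≔-other f u (# 1) (zero≢pos fu≡0 fq>0)

  -- A positive w keeps u supported in G − uv; v stays supported by a positive neighbour z ≠ u,
  -- or else by one raised from 0 to 1.
  inner-end-others-zero : ∀ {u v w} → Adj adj u v → ¬ Leaf adj u → ¬ Leaf adj v → Adj adj u w → w ≢ v → val f w ≡ 0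
  inner-end-others-zero {u} {v} {w} uv ¬lu ¬lv uw w≢v with val f w ℕ.≟ 0
  ... | yes fw≡0 = fw≡0
  ... | no fw≢0 with any? (λ z → (adj v z ≟ᵇ true) ×-dec ¬? (z ≟ u) ×-dec (0 ℕ.<? val f z))
  ...   | yes (z , vz , z≢u , fz>0) = ⊥-elim (no-cheap-removal uv ¬lu ¬lv at f-light)
    where
    at : ∀ p → TRDAt (removeEdge adj u v) f p
    at p with p ≟ u | p ≟ v
    ... | yes refl | _        = TRDAt-paired (inner-end-positive uv ¬lu ¬lv)
                                    (keep uw (inj₂ w≢v) (inj₁ (Adj⇒≢ G uv))) (ℕ.n≢0⇒n>0 fw≢0)
    ... | no _     | yes refl = TRDAt-paired (inner-end-positive (Adj-sym G uv) ¬lv ¬lu)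
                                    (keep vz (inj₁ (Adj⇒≢ G (Adj-sym G uv))) (inj₂ z≢u)) fz>0
    ... | no p≢u   | no p≢v   = transfer refl λ _ _ → inj₁ p≢u , inj₁ p≢v , refl
  ...   | no none with another-neighbour adj ¬lv (Adj-sym G uv)
  ...     | z , vz , z≢u = ⊥-elim (no-cheap-removal uv ¬lu ¬lv at (raise-light z fz≡0))
    where
    fz≡0 : val f z ≡ 0
    fz≡0 with val f z ℕ.≟ 0
    ... | yes fz≡0 = fz≡0
    ... | no fz≢0  = ⊥-elim (none (z , vz , z≢u , ℕ.n≢0⇒n>0 fz≢0))

    raised : ∀ {p} → p ≢ z → 0 < val f p → 0 < val (f [ z ≔ # 1 ]) p
    raised p≢z fp>0 = subst (0 <_) (sym (≔-other f z (# 1) p≢z)) fp>0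

    at : ∀ p → TRDAt (removeEdge adj u v) (f [ z ≔ # 1 ]) p
    at p with p ≟ z | p ≟ u | p ≟ v
    ... | yes refl | _ | _ = TRDAt-paired (>0-of (≔-same f z (# 1)))
                               (keep (Adj-sym G vz) (inj₁ z≢u) (inj₁ (Adj⇒≢ G vz ∘ sym)))
                               (raised (Adj⇒≢ G vz) (inner-end-positive (Adj-sym G uv) ¬lv ¬lu))
    ... | no p≢z | yes refl | _ = TRDAt-paired (raised p≢z (inner-end-positive uv ¬lu ¬lv))
                                    (keep uw (inj₂ w≢v) (inj₁ (Adj⇒≢ G uv)))
                                    (raised (zero≢pos fz≡0 (ℕ.n≢0⇒n>0 fw≢0)) (ℕ.n≢0⇒n>0 fw≢0))
    ... | no p≢z | no _ | yes refl = TRDAt-paired (raised p≢z (inner-end-positive (Adj-sym G uv) ¬lv ¬lu))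
                                       (keep vz (inj₁ (Adj⇒≢ G (Adj-sym G uv))) (inj₂ z≢u)) (>0-of (≔-same f z (# 1)))
    ... | no p≢z | no p≢u | no p≢v = transfer (≔-other f z (# 1) p≢z) λ _ fq>0 →
                                       inj₁ p≢u , inj₁ p≢v , ≔-other f z (# 1) (zero≢pos fz≡0 fq>0)

  inner-end-others-leaves : ∀ {u v w} → Adj adj u v → ¬ Leaf adj u → ¬ Leaf adj v → Adj adj u w → w ≢ v → Leaf adj w
  inner-end-others-leaves {w = w} uv ¬lu ¬lv uw w≢v with leaf? adj w
  ... | yes lw  = lw
  ... | no ¬lw = ⊥-elim (<⇒≢ (inner-end-positive (Adj-sym G uw) ¬lw ¬lu) (sym (inner-end-others-zero uv ¬lu ¬lv uw w≢v)))

  inner-end-value-2 : ∀ {u v} → Adj adj u v → ¬ Leaf adj u → ¬ Leaf adj v → val f u ≡ 2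
  inner-end-value-2 uv ¬lu ¬lv with another-neighbour adj ¬lu uv
  ... | w , uw , w≢v =
    let (q , wq , fq≡2) = IsTRDF.dom f-TRDF w (inner-end-others-zero uv ¬lu ¬lv uw w≢v)
    in subst (λ q → val f q ≡ 2) (leaf-unique adj (inner-end-others-leaves uv ¬lu ¬lv uw w≢v) (Adj-sym G uw) wq) fq≡2

  -- If N(u) = {v, w}, lowering u to 1 and raising w and a neighbour z ≠ u of v to 1 pairs u
  -- with w and z with v in G − uv.
  private
    module DegreeTwo {u v w z} (uv : Adj adj u v) (¬lu : ¬ Leaf adj u) (¬lv : ¬ Leaf adj v) (deg≤2 : deg adj u ≤ 2)
      (uw : Adj adj u w) (w≢v : w ≢ v) (vz : Adj adj v z) (z≢u : z ≢ u) where

      u≢v : u ≢ v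
      u≢v = Adj⇒≢ G uv

      u≢w : u ≢ w
      u≢w = Adj⇒≢ G uw

      v≢z : v ≢ z
      v≢z = Adj⇒≢ G vz

      fw≡0 : val f w ≡ 0
      fw≡0 = inner-end-others-zero uv ¬lu ¬lv uw w≢v

      fz≡0 : val f z ≡ 0
      fz≡0 = inner-end-others-zero (Adj-sym G uv) ¬lv ¬lu vz z≢u

      z≢w : z ≢ w
      z≢w refl = u≢v (sym (leaf-unique adj (inner-end-others-leaves uv ¬lu ¬lv uw w≢v) (Adj-sym G uw) (Adj-sym G vz)))

      g₁ g₂ g : Fin n → Fin 3
      g₁ = f [ u ≔ # 1 ]
      g₂ = g₁ [ w ≔ # 1 ]
      g  = g₂ [ z ≔ # 1 ]

      g-other : ∀ {p} → p ≢ u → p ≢ w → p ≢ z → val g p ≡ val f p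
      g-other p≢u p≢w p≢z = trans (≔-other g₂ z _ p≢z) (trans (≔-other g₁ w _ p≢w) (≔-other f u _ p≢u))

      g-u : val g u ≡ 1
      g-u = trans (≔-other g₂ z _ (z≢u ∘ sym)) (trans (≔-other g₁ w _ u≢w) (≔-same f u _))

      g-w : val g w ≡ 1
      g-w = trans (≔-other g₂ z _ (z≢w ∘ sym)) (≔-same g₁ w _)

      g-z : val g z ≡ 1
      g-z = ≔-same g₂ z _

      g-v : val g v ≡ 2
      g-v = trans (g-other (u≢v ∘ sym) (w≢v ∘ sym) v≢z) (inner-end-value-2 (Adj-sym G uv) ¬lv ¬lu)

      weight-g : weight g ≡ k + 1
      weight-g = ℕ.+-cancelʳ-≡ 2 _ _ (begin
        weight g + 2            ≡⟨ cong (_+ 2) (weight-raise g₂ z _ g₂z≡0) ⟩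
        weight g₂ + 1 + 2       ≡⟨ cong (λ s → s + 1 + 2) (weight-raise g₁ w _ g₁w≡0) ⟩
        weight g₁ + 1 + 1 + 2   ≡⟨ cong (_+ 2) (+-assoc (weight g₁) 1 1) ⟩
        weight g₁ + 2 + 2       ≡⟨ cong (λ s → weight g₁ + s + 2) (inner-end-value-2 uv ¬lu ¬lv) ⟨
        weight g₁ + val f u + 2 ≡⟨ cong (_+ 2) (trans (weight-≔ f u _) (cong (_+ 1) f-weight)) ⟩
        k + 1 + 2               ∎)
        where
        open ≡-Reasoning
        g₁w≡0 : val g₁ w ≡ 0
        g₁w≡0 = trans (≔-other f u _ (u≢w ∘ sym)) fw≡0
        g₂z≡0 : val g₂ z ≡ 0
        g₂z≡0 = trans (trans (≔-other g₁ w _ z≢w) (≔-other f u _ z≢u)) fz≡0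

      not-to-u : ∀ {p q} → Adj adj p q → p ≢ v → p ≢ w → q ≢ u
      not-to-u pq p≢v p≢w refl = [ p≢v , p≢w ] (deg≤2⇒neighbours adj deg≤2 uv uw w≢v (Adj-sym G pq))

      g-at : ∀ p → TRDAt (removeEdge adj u v) g p
      g-at p with p ≟ u | p ≟ w | p ≟ v | p ≟ z
      ... | yes refl | _ | _ | _ =
        TRDAt-paired (>0-of g-u) (keep uw (inj₂ w≢v) (inj₁ u≢v)) (>0-of g-w)
      ... | no _ | yes refl | _ | _ =
        TRDAt-paired (>0-of g-w) (keep (Adj-sym G uw) (inj₁ (u≢w ∘ sym)) (inj₁ w≢v)) (>0-of g-u)
      ... | no _ | no _ | yes refl | _ =
        TRDAt-paired (>0-of g-v) (keep vz (inj₁ (u≢v ∘ sym)) (inj₂ z≢u)) (>0-of g-z)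
      ... | no _ | no _ | no _ | yes refl =
        TRDAt-paired (>0-of g-z) (keep (Adj-sym G vz) (inj₁ z≢u) (inj₁ (v≢z ∘ sym))) (>0-of g-v)
      ... | no p≢u | no p≢w | no p≢v | no p≢z = transfer (g-other p≢u p≢w p≢z) λ pq fq>0 →
        inj₁ p≢u , inj₁ p≢v , g-other (not-to-u pq p≢v p≢w) (zero≢pos fw≡0 fq>0) (zero≢pos fz≡0 fq>0)

  inner-end-degree≥3 : ∀ {u v} → Adj adj u v → ¬ Leaf adj u → ¬ Leaf adj v → 3 ≤ deg adj u
  inner-end-degree≥3 {u} {v} uv ¬lu ¬lv with 3 ℕ.≤? deg adj u
  ... | yes 3≤deg = 3≤deg
  ... | no 3≰deg with another-neighbour adj ¬lu uv | another-neighbour adj ¬lv (Adj-sym G uv)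
  ...   | w , uw , w≢v | z , vz , z≢u = ⊥-elim (no-cheap-removal uv ¬lu ¬lv g-at (ℕ.≤-reflexive weight-g))
    where open DegreeTwo uv ¬lu ¬lv (≮⇒≥ 3≰deg) uw w≢v vz z≢u

  inner-edges-central : InnerEdgesAreCentral G
  inner-edges-central uv ¬lu ¬lv = inner-end-others-leaves uv ¬lu ¬lv , inner-end-degree≥3 uv ¬lu ¬lv

-- Splitting G into stars and double stars

record FibreLabelling {n} {B : Set} (φ : Fin n → B) : Set where
  field
    m        : ℕ
    label    : Fin n → Fin m
    sound    : ∀ {u v} → label u ≡ label v → φ u ≡ φ v
    complete : ∀ {u v} → φ u ≡ φ v → label u ≡ label v
    onto     : ∀ i → ∃[ v ] label v ≡ i

lookup-injective : ∀ {A : Set} {xs : List A} → Unique xs → ∀ {i j} → lookup xs i ≡ lookup xs j → i ≡ j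
lookup-injective (_  ∷ _)   {zero}  {zero}  _ = refl
lookup-injective (x∉ ∷ _)   {zero}  {suc j} e = ⊥-elim (All.lookup x∉ (∈-lookup j) e)
lookup-injective (x∉ ∷ _)   {suc i} {zero}  e = ⊥-elim (All.lookup x∉ (∈-lookup i) (sym e))
lookup-injective (_  ∷ xs!) {suc i} {suc j} e = cong suc (lookup-injective xs! e)

fibre-labelling : ∀ {n} {B : Set} → DecidableEquality B → (φ : Fin n → B) → FibreLabelling φ
fibre-labelling {n} {B} _≟B_ φ = record
  { m        = length L
  ; label    = label
  ; sound    = λ {u} {v} e → trans (label-spec u) (trans (cong (lookup L) e) (sym (label-spec v)))
  ; complete = λ {u} {v} e → lookup-injective L-unique (trans (sym (label-spec u)) (trans e (label-spec v)))
  ; onto     = λ i → let (v , _ , e) = ∈-map⁻ φ (∈-deduplicate⁻ _≟B_ (map φ (allFin n)) (∈-lookup i))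
                     in v , lookup-injective L-unique (trans (sym (label-spec v)) (sym e))
  }
  where
  L : List B
  L = deduplicate _≟B_ (map φ (allFin n))

  L-unique : Unique L
  L-unique = deduplicate-! _≟B_ (map φ (allFin n))

  member : ∀ v → φ v ∈ L
  member v = ∈-deduplicate⁺ _≟B_ (∈-map⁺ φ (∈-allFin v))

  label : Fin n → Fin (length L)
  label v = index (member v)

  label-spec : ∀ v → φ v ≡ lookup L (label v)
  label-spec v = lookup-index (member v)

module _ (G : Graph) where

  open Graph G using (n; adj)

  star-class : ∀ {m} {c : Fin n → Fin m} {i} x → c x ≡ i → ∃[ y ] (c y ≡ i × y ≢ x) →
    (∀ {v} → c v ≡ i → v ≢ x → Leaf adj v × Adj adj x v) → InducesStar adj c i
  star-class x cx other spokes =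
    x , cx , other , (λ y cy y≢x → proj₂ (spokes cy y≢x)) ,
    λ y z cy cz y≢x z≢x yz → let (ly , xy) = spokes cy y≢x in z≢x (leaf-unique adj ly (Adj-sym G xy) yz)

pair : ∀ {n} → Fin n → Fin n → Subset n
pair s t = ⁅ s ⁆ ∪ ⁅ t ⁆

∈-pair⁻ : ∀ {n} {z s t : Fin n} → z ∈ₛ pair s t → z ≡ s ⊎ z ≡ t
∈-pair⁻ {s = s} {t} z∈ = Sum.map (x∈⁅y⁆⇒x≡y s) (x∈⁅y⁆⇒x≡y t) (x∈p∪q⁻ ⁅ s ⁆ ⁅ t ⁆ z∈)

∈-pairˡ : ∀ {n} (s t : Fin n) → s ∈ₛ pair s t
∈-pairˡ s t = x∈p∪q⁺ (inj₁ (x∈⁅x⁆ s))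

module Decomposition (G : Graph) (no-isolated : NoIsolated (Graph.adj G)) (central : InnerEdgesAreCentral G) where

  open Graph G using (n; adj)

  nb : Fin n → Fin n
  nb = proj₁ ∘ no-isolated

  nb-adjacent : ∀ x → Adj adj x (nb x)
  nb-adjacent = proj₂ ∘ no-isolated

  leaf-nb : ∀ {x y} → Leaf adj x → Adj adj x y → nb x ≡ y
  leaf-nb lx xy = leaf-unique adj lx xy (nb-adjacent _)

  non-leaf-neighbour? : ∀ h → Dec (∃[ w ] (Adj adj h w × ¬ Leaf adj w))
  non-leaf-neighbour? h = any? λ w → (adj h w ≟ᵇ true) ×-dec ¬? (leaf? adj w)

  -- The other centre of the double star of h when h is one of its centres, and h itself otherwise.
  mate : Fin n → Fin n
  mate h with non-leaf-neighbour? h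
  ... | yes (w , _) = w
  ... | no _        = h

  mate-spec : ∀ h → (Adj adj h (mate h) × ¬ Leaf adj (mate h)) ⊎ (mate h ≡ h × ∀ {w} → Adj adj h w → Leaf adj w)
  mate-spec h with non-leaf-neighbour? h
  ... | yes (w , hw , ¬lw) = inj₁ (hw , ¬lw)
  ... | no none            = inj₂ (refl , λ {w} hw → decidable-stable (leaf? adj w) λ ¬lw → none (w , hw , ¬lw))

  mate-unique : ∀ {h w} → ¬ Leaf adj h → Adj adj h w → ¬ Leaf adj w → mate h ≡ w
  mate-unique {h} {w} ¬lh hw ¬lw with mate-spec h
  ... | inj₂ (_ , all-leaves) = ⊥-elim (¬lw (all-leaves hw))
  ... | inj₁ (hm , ¬lm) with mate h ≟ w
  ...   | yes m≡w = m≡w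
  ...   | no m≢w  = ⊥-elim (¬lm (proj₁ (central hw ¬lh ¬lw) hm m≢w))

  mate-non-leaf : ∀ {h} → ¬ Leaf adj h → ¬ Leaf adj (mate h)
  mate-non-leaf {h} ¬lh with mate-spec h
  ... | inj₁ (_ , ¬lm) = ¬lm
  ... | inj₂ (m≡h , _) = subst (¬_ ∘ Leaf adj) (sym m≡h) ¬lh

  hub-centres : Fin n → Subset n
  hub-centres h = pair h (mate h)

  data Kind (v : Fin n) : Set where
    hub     : ¬ Leaf adj v → Kind v
    pendant : Leaf adj v → ¬ Leaf adj (nb v) → Kind v
    twin    : Leaf adj v → Leaf adj (nb v) → Kind v

  kind : ∀ v → Kind v
  kind v with leaf? adj v | leaf? adj (nb v)
  ... | no ¬lv | _       = hub ¬lv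
  ... | yes lv | no ¬lnv = pendant lv ¬lnv
  ... | yes lv | yes lnv = twin lv lnv

  -- The centres of the component of v: the centre of its star, both centres of its double star,
  -- or both vertices of a K₂. The components are the fibres of centres.
  centres : Fin n → Subset n
  centres v with kind v
  ... | hub _       = hub-centres v
  ... | pendant _ _ = hub-centres (nb v)
  ... | twin _ _    = pair v (nb v)

  centres-hub : ∀ {h} → ¬ Leaf adj h → centres h ≡ hub-centres h
  centres-hub {h} ¬lh with kind h
  ... | hub _        = refl
  ... | pendant lh _ = ⊥-elim (¬lh lh)
  ... | twin lh _    = ⊥-elim (¬lh lh)

  centres-twin : ∀ {v} → Leaf adj v → Leaf adj (nb v) → centres v ≡ pair v (nb v)
  centres-twin {v} lv lnv with kind v
  ... | hub ¬lv        = ⊥-elim (¬lv lv)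
  ... | pendant _ ¬lnv = ⊥-elim (¬lnv lnv)
  ... | twin _ _       = refl

  centres-edge : ∀ {u v} → Adj adj u v → centres u ≡ centres v
  centres-edge {u} {v} uv with kind u | kind v
  ... | hub ¬lu | hub ¬lv rewrite mate-unique ¬lu uv ¬lv | mate-unique ¬lv (Adj-sym G uv) ¬lu = ∪-comm ⁅ u ⁆ ⁅ v ⁆
  ... | hub _ | pendant lv _ = cong hub-centres (sym (leaf-nb lv (Adj-sym G uv)))
  ... | hub ¬lu | twin lv lnv = ⊥-elim (¬lu (subst (Leaf adj) (leaf-nb lv (Adj-sym G uv)) lnv))
  ... | pendant lu _ | hub _ = cong hub-centres (leaf-nb lu uv)
  ... | pendant lu ¬lnu | pendant lv _ = ⊥-elim (¬lnu (subst (Leaf adj) (sym (leaf-nb lu uv)) lv))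
  ... | pendant lu ¬lnu | twin lv _ = ⊥-elim (¬lnu (subst (Leaf adj) (sym (leaf-nb lu uv)) lv))
  ... | twin lu lnu | hub ¬lv = ⊥-elim (¬lv (subst (Leaf adj) (leaf-nb lu uv) lnu))
  ... | twin lu _ | pendant lv ¬lnv = ⊥-elim (¬lnv (subst (Leaf adj) (sym (leaf-nb lv (Adj-sym G uv))) lu))
  ... | twin lu _ | twin lv _ rewrite leaf-nb lu uv | leaf-nb lv (Adj-sym G uv) = ∪-comm ⁅ u ⁆ ⁅ v ⁆

  hub-class-member : ∀ {h v} → ¬ Leaf adj h → centres v ≡ hub-centres h →
    v ≡ h ⊎ v ≡ mate h ⊎ (Leaf adj v × (Adj adj h v ⊎ Adj adj (mate h) v))
  hub-class-member {h} {v} ¬lh e with kind v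
  ... | hub _ = [ inj₁ , inj₂ ∘ inj₁ ] (∈-pair⁻ (subst (v ∈ₛ_) e (∈-pairˡ v (mate v))))
  ... | pendant lv _ = inj₂ (inj₂ (lv , Sum.map to-v to-v (∈-pair⁻ (subst (nb v ∈ₛ_) e (∈-pairˡ (nb v) (mate (nb v)))))))
    where
    to-v : ∀ {w} → nb v ≡ w → Adj adj w v
    to-v refl = Adj-sym G (nb-adjacent v)
  ... | twin lv _ = ⊥-elim ([ (λ v≡h → ¬lh (subst (Leaf adj) v≡h lv))
                            , (λ v≡m → mate-non-leaf ¬lh (subst (Leaf adj) v≡m lv)) ]
                            (∈-pair⁻ (subst (v ∈ₛ_) e (∈-pairˡ v (nb v)))))

  pair-leaves : ∀ {s t z} → Leaf adj s → Leaf adj t → z ∈ₛ pair s t → Leaf adj z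
  pair-leaves ls lt z∈ = [ (λ { refl → ls }) , (λ { refl → lt }) ] (∈-pair⁻ z∈)

  twin-class-member : ∀ {ρ v} → Leaf adj ρ → Leaf adj (nb ρ) → centres v ≡ pair ρ (nb ρ) → v ≡ ρ ⊎ v ≡ nb ρ
  twin-class-member {ρ} {v} lρ lnρ e with kind v
  ... | hub ¬lv        = ⊥-elim (¬lv (pair-leaves lρ lnρ (subst (v ∈ₛ_) e (∈-pairˡ v (mate v)))))
  ... | pendant _ ¬lnv = ⊥-elim (¬lnv (pair-leaves lρ lnρ (subst (nb v ∈ₛ_) e (∈-pairˡ (nb v) (mate (nb v))))))
  ... | twin _ _       = ∈-pair⁻ (subst (v ∈ₛ_) e (∈-pairˡ v (nb v)))

  module Classes (L : FibreLabelling centres) where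

    open FibreLabelling L

    same-label : ∀ {u v} → Adj adj u v → label u ≡ label v
    same-label = complete ∘ centres-edge

    same-centres : ∀ {i u v} → label u ≡ i → label v ≡ i → centres u ≡ centres v
    same-centres lu≡i lv≡i = sound (trans lu≡i (sym lv≡i))

    nb-in-class : ∀ {i x} → label x ≡ i → label (nb x) ≡ i
    nb-in-class {x = x} lx≡i = trans (sym (same-label (nb-adjacent x))) lx≡i

    hub-star : ∀ {h i} → ¬ Leaf adj h → label h ≡ i → mate h ≡ h → InducesStar adj label i
    hub-star {h} {i} ¬lh lh≡i m≡h = star-class G h lh≡i (nb h , nb-in-class lh≡i , Adj⇒≢ G (nb-adjacent h) ∘ sym) spoke
      where
      spoke : ∀ {v} → label v ≡ i → v ≢ h → Leaf adj v × Adj adj h v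
      spoke {v} lv≡i v≢h with hub-class-member ¬lh (trans (same-centres lv≡i lh≡i) (centres-hub ¬lh))
      ... | inj₁ v≡h                   = ⊥-elim (v≢h v≡h)
      ... | inj₂ (inj₁ v≡m)            = ⊥-elim (v≢h (trans v≡m m≡h))
      ... | inj₂ (inj₂ (lv , inj₁ hv)) = lv , hv
      ... | inj₂ (inj₂ (lv , inj₂ mv)) = lv , subst (λ w → Adj adj w v) m≡h mv

    hub-double-star : ∀ {h i} → ¬ Leaf adj h → label h ≡ i → Adj adj h (mate h) → ¬ Leaf adj (mate h) →
      InducesDoubleStar3 adj label i
    hub-double-star {h} {i} ¬lh lh≡i hw ¬lw =
      h , w , lh≡i , trans (sym (same-label hw)) lh≡i , Adj⇒≢ G hw , hw , exact , apart ,
      proj₂ (central hw ¬lh ¬lw) , proj₂ (central (Adj-sym G hw) ¬lw ¬lh)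
      where
      w = mate h

      leaf-member : ∀ {z} → label z ≡ i → z ≢ h → z ≢ w → Leaf adj z × (Adj adj h z ⊎ Adj adj w z)
      leaf-member lz≡i z≢h z≢w with hub-class-member ¬lh (trans (same-centres lz≡i lh≡i) (centres-hub ¬lh))
      ... | inj₁ z≡h        = ⊥-elim (z≢h z≡h)
      ... | inj₂ (inj₁ z≡w) = ⊥-elim (z≢w z≡w)
      ... | inj₂ (inj₂ r)   = r

      exact : ∀ z → label z ≡ i → z ≢ h → z ≢ w → (Adj adj h z × ¬ Adj adj w z) ⊎ (Adj adj w z × ¬ Adj adj h z)
      exact z lz≡i z≢h z≢w with leaf-member lz≡i z≢h z≢w
      ... | lz , inj₁ hz = inj₁ (hz , λ wz → Adj⇒≢ G hw (leaf-unique adj lz (Adj-sym G wz) (Adj-sym G hz)))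
      ... | lz , inj₂ wz = inj₂ (wz , λ hz → Adj⇒≢ G hw (sym (leaf-unique adj lz (Adj-sym G hz) (Adj-sym G wz))))

      apart : ∀ z z′ → label z ≡ i → label z′ ≡ i → z ≢ h → z ≢ w → z′ ≢ h → z′ ≢ w → ¬ Adj adj z z′
      apart z z′ lz≡i _ z≢h z≢w z′≢h z′≢w zz′ with leaf-member lz≡i z≢h z≢w
      ... | lz , inj₁ hz = z′≢h (leaf-unique adj lz (Adj-sym G hz) zz′)
      ... | lz , inj₂ wz = z′≢w (leaf-unique adj lz (Adj-sym G wz) zz′)

    hub-class : ∀ {h i} → ¬ Leaf adj h → label h ≡ i → InducesStar adj label i ⊎ InducesDoubleStar3 adj label i
    hub-class {h} ¬lh lh≡i with mate-spec h
    ... | inj₁ (hw , ¬lw) = inj₂ (hub-double-star ¬lh lh≡i hw ¬lw)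
    ... | inj₂ (m≡h , _)  = inj₁ (hub-star ¬lh lh≡i m≡h)

    class-shape : ∀ {ρ i} → label ρ ≡ i → Kind ρ → InducesStar adj label i ⊎ InducesDoubleStar3 adj label i
    class-shape lρ≡i (hub ¬lρ)              = hub-class ¬lρ lρ≡i
    class-shape lρ≡i (pendant _ ¬lnρ)       = hub-class ¬lnρ (nb-in-class lρ≡i)
    class-shape {ρ} {i} lρ≡i (twin lρ lnρ) =
      inj₁ (star-class G ρ lρ≡i (nb ρ , nb-in-class lρ≡i , Adj⇒≢ G (nb-adjacent ρ) ∘ sym) spoke)
      where
      spoke : ∀ {v} → label v ≡ i → v ≢ ρ → Leaf adj v × Adj adj ρ v
      spoke {v} lv≡i v≢ρ with twin-class-member lρ lnρ (trans (same-centres lv≡i lρ≡i) (centres-twin lρ lnρ))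
      ... | inj₁ v≡ρ  = ⊥-elim (v≢ρ v≡ρ)
      ... | inj₂ refl = lnρ , nb-adjacent ρ

  centres-labelling : FibreLabelling centres
  centres-labelling = fibre-labelling (≡-dec _≟ᵇ_) centres

  decomposition : 1 ≤ n → UnionOfStarsAndDoubleStars G
  decomposition 1≤n =
    m , ≤-trans (s≤s z≤n) (toℕ<n (label (fromℕ< 1≤n))) , label , (λ u v → same-label) ,
    λ i → class-shape (proj₂ (onto i)) (kind _)
    where
    open FibreLabelling centres-labelling
    open Classes centres-labelling

all-ones-TRDF : ∀ {n} {a : Adjacency n} → NoIsolated a → IsTRDF a (λ _ → # 1)
all-ones-TRDF no-isolated = record
  { dom   = λ _ ()
  ; total = λ v _ → proj₁ (no-isolated v) , proj₂ (no-isolated v) , s≤s z≤n }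

supercritical⇒union : (G : Graph) → 1 ≤ Graph.n G → NoIsolated (Graph.adj G) → ERSupercritical G → UnionOfStarsAndDoubleStars G
supercritical⇒union G 1≤n no-isolated sc =
  let (_ , γ) = γtR-exists (Graph.adj G) (all-ones-TRDF no-isolated)
  in Decomposition.decomposition G no-isolated (Supercritical.inner-edges-central G sc γ) 1≤n

-- Double stars are supercritical

PendantsAt : ∀ {n} → Adjacency n → Fin n → Fin n → Set
PendantsAt a x y = ∀ {z q} → Adj a x z → z ≢ y → Adj a z q → q ≡ x

HeavyPendants : ∀ {n} → Adjacency n → (Fin n → Fin 3) → Fin n → Fin n → Set
HeavyPendants a f x y =
  ∃[ l₁ ] ∃[ l₂ ] (Adj a x l₁ × Adj a x l₂ × l₁ ≢ y × l₂ ≢ y × l₁ ≢ l₂ × 3 ≤ val f x + val f l₁ + val f l₂)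

heavy-pendants : ∀ {n} {a a′ : Adjacency n} {f x y} → (∀ {p q} → Adj a′ p q → Adj a p q) → IsTRDF a′ f →
  ¬ Adj a′ x y → 3 ≤ deg a x → Adj a x y → PendantsAt a x y → HeavyPendants a f x y
heavy-pendants {a = a} {a′} {f} {x} {y} a′⊆a t ¬x′y d xy pendant = by-value (f x) refl (two-other-neighbours a d xy)
  where
  off-y : ∀ {q} → Adj a′ x q → q ≢ y
  off-y x′q refl = ¬x′y x′q

  positive : toℕ (f x) ≢ 2 → ∀ {z} → Adj a x z → z ≢ y → 0 < val f z
  positive fx≢2 {z} xz z≢y with val f z ℕ.≟ 0
  ... | no fz≢0  = ℕ.n≢0⇒n>0 fz≢0
  ... | yes fz≡0 =
    let (q , z′q , fq≡2) = IsTRDF.dom t z fz≡0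
    in ⊥-elim (fx≢2 (subst (λ s → val f s ≡ 2) (pendant xz z≢y (a′⊆a z′q)) fq≡2))

  by-value : ∀ c → f x ≡ c → ∃[ z₁ ] ∃[ z₂ ] (Adj a x z₁ × Adj a x z₂ × z₁ ≢ y × z₂ ≢ y × z₁ ≢ z₂) →
    HeavyPendants a f x y
  by-value zero fx _ =
    let (q , x′q , fq≡2)    = IsTRDF.dom t x (cong toℕ fx)
        (q′ , q′q′ , fq′>0) = IsTRDF.total t q (>0-of fq≡2)
        fx>0                = subst (λ s → 0 < val f s) (pendant (a′⊆a x′q) (off-y x′q) (a′⊆a q′q′)) fq′>0
    in ⊥-elim (<⇒≢ fx>0 (sym (cong toℕ fx)))
  by-value (suc zero) fx (z₁ , z₂ , xz₁ , xz₂ , z₁≢y , z₂≢y , z₁≢z₂) =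
    z₁ , z₂ , xz₁ , xz₂ , z₁≢y , z₂≢y , z₁≢z₂ ,
    subst (λ s → 3 ≤ s + val f z₁ + val f z₂) (sym (cong toℕ fx))
          (ℕ.+-mono-≤ (s≤s (positive fx≢2 xz₁ z₁≢y)) (positive fx≢2 xz₂ z₂≢y))
    where
    fx≢2 : toℕ (f x) ≢ 2
    fx≢2 e = case trans (sym (cong toℕ fx)) e of λ ()
  by-value (suc (suc zero)) fx (z₁ , z₂ , xz₁ , xz₂ , z₁≢y , z₂≢y , z₁≢z₂) =
    let (q , x′q , fq>0) = IsTRDF.total t x (subst (0 <_) (sym (cong toℕ fx)) (s≤s z≤n))
        (l , xl , l≢y , l≢q) = avoiding q
    in q , l , a′⊆a x′q , xl , off-y x′q , l≢y , l≢q ∘ sym ,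
       subst (λ s → 3 ≤ s + val f q + val f l) (sym (cong toℕ fx)) (≤-trans (ℕ.+-monoʳ-≤ 2 fq>0) (ℕ.m≤m+n _ _))
    where
    avoiding : ∀ q → ∃[ l ] (Adj a x l × l ≢ y × l ≢ q)
    avoiding q with z₁ ≟ q
    ... | yes z₁≡q = z₂ , xz₂ , z₂≢y , λ z₂≡q → z₁≢z₂ (trans z₁≡q (sym z₂≡q))
    ... | no z₁≢q  = z₁ , xz₁ , z₁≢y , z₁≢q

concentrate : ∀ {n} → (Fin n → Fin 3) → Fin n → Fin n → Fin n → Fin n → Fin 3
concentrate f x l₁ l₂ = f [ l₁ ≔ # 0 ] [ l₂ ≔ # 0 ] [ x ≔ # 2 ]

module _ {n} (f : Fin n → Fin 3) {x l₁ l₂ : Fin n} (l₁≢x : l₁ ≢ x) (l₂≢x : l₂ ≢ x) (l₁≢l₂ : l₁ ≢ l₂) where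

  concentrate-centre : val (concentrate f x l₁ l₂) x ≡ 2
  concentrate-centre = ≔-same _ x (# 2)

  concentrate-pendant : ∀ {l} → l ≡ l₁ ⊎ l ≡ l₂ → val (concentrate f x l₁ l₂) l ≡ 0
  concentrate-pendant (inj₁ refl) = trans (≔-other _ x _ l₁≢x) (trans (≔-other _ l₂ _ l₁≢l₂) (≔-same f l₁ _))
  concentrate-pendant (inj₂ refl) = trans (≔-other _ x _ l₂≢x) (≔-same _ l₂ _)

  concentrate-other : ∀ {p} → p ≢ x → p ≢ l₁ → p ≢ l₂ → val (concentrate f x l₁ l₂) p ≡ val f p
  concentrate-other p≢x p≢l₁ p≢l₂ =
    trans (≔-other _ x _ p≢x) (trans (≔-other _ l₂ _ p≢l₂) (≔-other f l₁ _ p≢l₁))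

  concentrate-saves : 3 ≤ val f x + val f l₁ + val f l₂ → weight (concentrate f x l₁ l₂) + 1 ≤ weight f
  concentrate-saves heavy = ℕ.+-cancelʳ-≤ 2 _ _ (begin
    weight g + 1 + 2                           ≡⟨ +-assoc (weight g) 1 2 ⟩
    weight g + 3                               ≤⟨ ℕ.+-monoʳ-≤ (weight g) heavy ⟩
    weight g + (val f x + val f l₁ + val f l₂) ≡⟨ shuffle (weight g) (val f x) (val f l₁) (val f l₂) ⟩
    weight g + val f x + val f l₂ + val f l₁   ≡⟨ cong (λ s → weight g + s + val f l₂ + val f l₁) f₂x≡fx ⟨
    weight g + val f₂ x + val f l₂ + val f l₁  ≡⟨ cong (λ s → s + val f l₂ + val f l₁) (weight-≔ f₂ x (# 2)) ⟩
    weight f₂ + 2 + val f l₂ + val f l₁        ≡⟨ bring-2-out (weight f₂) (val f l₂) (val f l₁) ⟩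
    weight f₂ + val f l₂ + val f l₁ + 2        ≡⟨ cong (λ s → s + val f l₁ + 2) (trans (cong (weight f₂ +_) (sym f₁l₂≡fl₂)) (lower f₁ l₂)) ⟩
    weight f₁ + val f l₁ + 2                   ≡⟨ cong (_+ 2) (lower f l₁) ⟩
    weight f + 2                               ∎)
    where
    open ℕ.≤-Reasoning
    f₁ f₂ g : Fin n → Fin 3
    f₁ = f [ l₁ ≔ # 0 ]
    f₂ = f₁ [ l₂ ≔ # 0 ]
    g  = concentrate f x l₁ l₂
    f₂x≡fx : val f₂ x ≡ val f x
    f₂x≡fx = trans (≔-other f₁ l₂ _ (l₂≢x ∘ sym)) (≔-other f l₁ _ (l₁≢x ∘ sym))
    f₁l₂≡fl₂ : val f₁ l₂ ≡ val f l₂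
    f₁l₂≡fl₂ = ≔-other f l₁ _ (l₁≢l₂ ∘ sym)
    lower : ∀ h l → weight (h [ l ≔ # 0 ]) + val h l ≡ weight h
    lower h l = trans (weight-≔ h l (# 0)) (+-identityʳ (weight h))
    shuffle : ∀ w a b c → w + (a + b + c) ≡ w + a + c + b
    shuffle = solve-∀
    bring-2-out : ∀ w b c → w + 2 + b + c ≡ w + b + c + 2
    bring-2-out = solve-∀

module DoubleStarEdge (G : Graph) {a′ : Adjacency (Graph.n G)} (a′⊆ : ∀ {p q} → Adj a′ p q → Adj (Graph.adj G) p q)
  {x y : Fin (Graph.n G)} (xy : Adj (Graph.adj G) x y)
  (x-pendants : PendantsAt (Graph.adj G) x y) (y-pendants : PendantsAt (Graph.adj G) y x) where

  open Graph G using (n; adj)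

  module Concentration {f} (t : IsTRDF a′ f) {l₁ l₂ m₁ m₂ : Fin n}
    (chosen-x : ∀ {l} → l ≡ l₁ ⊎ l ≡ l₂ → Adj adj x l × l ≢ y) (l₁≢l₂ : l₁ ≢ l₂)
    (chosen-y : ∀ {m} → m ≡ m₁ ⊎ m ≡ m₂ → Adj adj y m × m ≢ x) (m₁≢m₂ : m₁ ≢ m₂) where

    x≢y : x ≢ y
    x≢y = Adj⇒≢ G xy

    ≢x : ∀ {l} → l ≡ l₁ ⊎ l ≡ l₂ → l ≢ x
    ≢x cl l≡x = Adj⇒≢ G (proj₁ (chosen-x cl)) (sym l≡x)

    ≢y : ∀ {m} → m ≡ m₁ ⊎ m ≡ m₂ → m ≢ y
    ≢y cm m≡y = Adj⇒≢ G (proj₁ (chosen-y cm)) (sym m≡y)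

    sides-apart : ∀ {l m} → l ≡ l₁ ⊎ l ≡ l₂ → m ≡ m₁ ⊎ m ≡ m₂ → l ≢ m
    sides-apart cl cm refl = x≢y (sym (x-pendants (proj₁ (chosen-x cl)) (proj₂ (chosen-x cl)) (Adj-sym G (proj₁ (chosen-y cm)))))

    h g : Fin n → Fin 3
    h = concentrate f x l₁ l₂
    g = concentrate h y m₁ m₂

    h-other : ∀ {p} → p ≢ x → (p ≡ l₁ ⊎ p ≡ l₂ → ⊥) → val h p ≡ val f p
    h-other p≢x ¬cx = concentrate-other f (≢x (inj₁ refl)) (≢x (inj₂ refl)) l₁≢l₂ p≢x (¬cx ∘ inj₁) (¬cx ∘ inj₂)

    g-other : ∀ {p} → p ≢ y → (p ≡ m₁ ⊎ p ≡ m₂ → ⊥) → val g p ≡ val h p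
    g-other p≢y ¬cy = concentrate-other h (≢y (inj₁ refl)) (≢y (inj₂ refl)) m₁≢m₂ p≢y (¬cy ∘ inj₁) (¬cy ∘ inj₂)

    g-y : val g y ≡ 2
    g-y = concentrate-centre h (≢y (inj₁ refl)) (≢y (inj₂ refl)) m₁≢m₂

    g-x : val g x ≡ 2
    g-x = trans (g-other x≢y λ cm → proj₂ (chosen-y cm) refl)
                (concentrate-centre f (≢x (inj₁ refl)) (≢x (inj₂ refl)) l₁≢l₂)

    g-chosen-y : ∀ {m} → m ≡ m₁ ⊎ m ≡ m₂ → val g m ≡ 0
    g-chosen-y = concentrate-pendant h (≢y (inj₁ refl)) (≢y (inj₂ refl)) m₁≢m₂

    g-chosen-x : ∀ {l} → l ≡ l₁ ⊎ l ≡ l₂ → val g l ≡ 0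
    g-chosen-x cl = trans (g-other (proj₂ (chosen-x cl)) λ cm → sides-apart cl cm refl)
                          (concentrate-pendant f (≢x (inj₁ refl)) (≢x (inj₂ refl)) l₁≢l₂ cl)

    g-rest : ∀ {p} → p ≢ x → p ≢ y → (p ≡ l₁ ⊎ p ≡ l₂ → ⊥) → (p ≡ m₁ ⊎ p ≡ m₂ → ⊥) → val g p ≡ val f p
    g-rest p≢x p≢y ¬cx ¬cy = trans (g-other p≢y ¬cy) (h-other p≢x ¬cx)

    near : ∀ {p q} → Adj adj p q → p ≢ x → p ≢ y → val g q ≡ val f q ⊎ val g q ≡ 2
    near {p} {q} pq p≢x p≢y with q ≟ x | q ≟ y
    ... | yes refl | _        = inj₂ g-x
    ... | no _     | yes refl = inj₂ g-y
    ... | no q≢x   | no q≢y   = inj₁ (g-rest q≢x q≢y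
      (λ cq → p≢x (x-pendants (proj₁ (chosen-x cq)) (proj₂ (chosen-x cq)) (Adj-sym G pq)))
      (λ cq → p≢y (y-pendants (proj₁ (chosen-y cq)) (proj₂ (chosen-y cq)) (Adj-sym G pq))))

    g-TRDF : IsTRDF adj g
    g-TRDF = TRDAt⇒IsTRDF at
      where
      at : ∀ p → TRDAt adj g p
      at p with p ≟ x | p ≟ y | (p ≟ l₁) ⊎-dec (p ≟ l₂) | (p ≟ m₁) ⊎-dec (p ≟ m₂)
      ... | yes refl | _ | _ | _              = TRDAt-paired (>0-of g-x) xy (>0-of g-y)
      ... | no _ | yes refl | _ | _           = TRDAt-paired (>0-of g-y) (Adj-sym G xy) (>0-of g-x)
      ... | no _ | no _ | yes cx | _          = TRDAt-dominated (g-chosen-x cx) (Adj-sym G (proj₁ (chosen-x cx))) g-x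
      ... | no _ | no _ | no _ | yes cy       = TRDAt-dominated (g-chosen-y cy) (Adj-sym G (proj₁ (chosen-y cy))) g-y
      ... | no p≢x | no p≢y | no ¬cx | no ¬cy =
        TRDAt-transfer (IsTRDF⇒TRDAt t p) (g-rest p≢x p≢y ¬cx ¬cy) λ p′q _ → a′⊆ p′q , near (a′⊆ p′q) p≢x p≢y

    g-saves-2 : 3 ≤ val f x + val f l₁ + val f l₂ → 3 ≤ val f y + val f m₁ + val f m₂ → weight g + 2 ≤ weight f
    g-saves-2 heavy-x heavy-y = begin
      weight g + 2     ≡⟨ +-assoc (weight g) 1 1 ⟨
      weight g + 1 + 1 ≤⟨ ℕ.+-monoˡ-≤ 1 (concentrate-saves h (≢y (inj₁ refl)) (≢y (inj₂ refl)) m₁≢m₂ heavy-y′) ⟩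
      weight h + 1     ≤⟨ concentrate-saves f (≢x (inj₁ refl)) (≢x (inj₂ refl)) l₁≢l₂ heavy-x ⟩
      weight f         ∎
      where
      open ℕ.≤-Reasoning
      on-y-side : ∀ {m} → m ≡ y ⊎ (m ≡ m₁ ⊎ m ≡ m₂) → val h m ≡ val f m
      on-y-side (inj₁ refl) = h-other (x≢y ∘ sym) λ cl → proj₂ (chosen-x cl) refl
      on-y-side (inj₂ cm)   = h-other (proj₂ (chosen-y cm)) λ cl → sides-apart cl cm refl
      heavy-y′ : 3 ≤ val h y + val h m₁ + val h m₂
      heavy-y′ rewrite on-y-side (inj₁ refl) | on-y-side (inj₂ (inj₁ refl)) | on-y-side (inj₂ (inj₂ refl)) = heavy-y

  cheaper : ¬ Adj a′ x y → ¬ Adj a′ y x → 3 ≤ deg adj x → 3 ≤ deg adj y →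
    ∀ {f} → IsTRDF a′ f → ∃[ g ] (IsTRDF adj g × weight g + 2 ≤ weight f)
  cheaper ¬x′y ¬y′x dx dy {f} t =
    combine (heavy-pendants a′⊆ t ¬x′y dx xy x-pendants) (heavy-pendants a′⊆ t ¬y′x dy (Adj-sym G xy) y-pendants)
    where
    combine : HeavyPendants adj f x y → HeavyPendants adj f y x → ∃[ g ] (IsTRDF adj g × weight g + 2 ≤ weight f)
    combine (l₁ , l₂ , xl₁ , xl₂ , l₁≢y , l₂≢y , l₁≢l₂ , heavy-x)
            (m₁ , m₂ , ym₁ , ym₂ , m₁≢x , m₂≢x , m₁≢m₂ , heavy-y) =
      g , g-TRDF , g-saves-2 heavy-x heavy-y
      where
      chosen-x : ∀ {l} → l ≡ l₁ ⊎ l ≡ l₂ → Adj adj x l × l ≢ y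
      chosen-x (inj₁ refl) = xl₁ , l₁≢y
      chosen-x (inj₂ refl) = xl₂ , l₂≢y

      chosen-y : ∀ {m} → m ≡ m₁ ⊎ m ≡ m₂ → Adj adj y m × m ≢ x
      chosen-y (inj₁ refl) = ym₁ , m₁≢x
      chosen-y (inj₂ refl) = ym₂ , m₂≢x

      open Concentration t chosen-x l₁≢l₂ chosen-y m₁≢m₂

module _ (G : Graph) {m} {c : Fin (Graph.n G) → Fin m} (c-edge : ∀ u v → Adj (Graph.adj G) u v → c u ≡ c v) where

  open Graph G using (n; adj)

  same-class : ∀ {i u v} → c u ≡ i → Adj adj u v → c v ≡ i
  same-class cu uv = trans (sym (c-edge _ _ uv)) cu

  star-spoke-leaf : ∀ {i} (s : InducesStar adj c i) {v} → c v ≡ i → v ≢ proj₁ s → Leaf adj v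
  star-spoke-leaf (x , _ , _ , spokes , apart) {v} cv v≢x = leaf-intro adj (Adj-sym G (spokes v cv v≢x)) only-x
    where
    only-x : ∀ q → Adj adj v q → q ≡ x
    only-x q vq with q ≟ x
    ... | yes q≡x = q≡x
    ... | no q≢x  = ⊥-elim (apart v q cv (same-class cv vq) v≢x q≢x vq)

  star-edge-leaf : ∀ {u v} → InducesStar adj c (c u) → Adj adj u v → Leaf adj u ⊎ Leaf adj v
  star-edge-leaf {u} {v} s uv with u ≟ proj₁ s
  ... | yes u≡x = inj₂ (star-spoke-leaf s (same-class refl uv) λ v≡x → Adj⇒≢ G uv (trans u≡x (sym v≡x)))
  ... | no u≢x  = inj₁ (star-spoke-leaf s refl u≢x)

  centre-pendants : ∀ {i x y} → c x ≡ i →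
    (∀ z → c z ≡ i → z ≢ x → z ≢ y → (Adj adj x z × ¬ Adj adj y z) ⊎ (Adj adj y z × ¬ Adj adj x z)) →
    (∀ z w → c z ≡ i → c w ≡ i → z ≢ x → z ≢ y → w ≢ x → w ≢ y → ¬ Adj adj z w) →
    PendantsAt adj x y
  centre-pendants {x = x} {y} cx exact apart {z} {q} xz z≢y zq
    with exact z (same-class cx xz) (Adj⇒≢ G xz ∘ sym) z≢y | q ≟ x | q ≟ y
  ... | inj₂ (_ , ¬xz) | _       | _        = ⊥-elim (¬xz xz)
  ... | inj₁ _         | yes q≡x | _        = q≡x
  ... | inj₁ (_ , ¬yz) | no _    | yes refl = ⊥-elim (¬yz (Adj-sym G zq))
  ... | inj₁ _         | no q≢x  | no q≢y   =
    ⊥-elim (apart z q (same-class cx xz) (same-class (same-class cx xz) zq) (Adj⇒≢ G xz ∘ sym) z≢y q≢x q≢y zq)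

  double-star-non-leaf : ∀ {i x y z} → PendantsAt adj x y → PendantsAt adj y x →
    (∀ z → c z ≡ i → z ≢ x → z ≢ y → (Adj adj x z × ¬ Adj adj y z) ⊎ (Adj adj y z × ¬ Adj adj x z)) →
    c z ≡ i → ¬ Leaf adj z → z ≡ x ⊎ z ≡ y
  double-star-non-leaf {x = x} {y} {z} px py exact cz ¬lz with z ≟ x | z ≟ y
  ... | yes z≡x | _       = inj₁ z≡x
  ... | no _    | yes z≡y = inj₂ z≡y
  ... | no z≢x  | no z≢y  = ⊥-elim (¬lz ([ (λ (xz , _) → leaf-intro adj (Adj-sym G xz) λ q → px xz z≢y)
                                          , (λ (yz , _) → leaf-intro adj (Adj-sym G yz) λ q → py yz z≢x) ] (exact z cz z≢x z≢y)))

union⇒supercritical : (G : Graph) → UnionOfStarsAndDoubleStars G → ERSupercritical G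
union⇒supercritical G (_ , _ , c , c-edge , shape) u v uv ¬lu ¬lv k k′ γ γ′ with shape (c u)
... | inj₁ s = ⊥-elim ([ ¬lu , ¬lv ] (star-edge-leaf G c-edge s uv))
... | inj₂ (x , y , cx , cy , _ , xy , exact , apart , dx , dy) =
  let (f′ , t′ , f′≡k′)   = proj₁ γ′
      (g , g-TRDF , saving) = DoubleStarEdge.cheaper G (removeEdge-⊆ adj u v) xy px py
                                (removeEdge-removes adj u v ends) (removeEdge-removes adj u v ends-swapped) dx dy t′
  in ≤-trans (ℕ.+-monoˡ-≤ 2 (proj₂ γ g g-TRDF)) (subst (weight g + 2 ≤_) f′≡k′ saving)
  where
  open Graph G using (adj)

  exact-swapped : ∀ z → c z ≡ c u → z ≢ y → z ≢ x → (Adj adj y z × ¬ Adj adj x z) ⊎ (Adj adj x z × ¬ Adj adj y z)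
  exact-swapped z cz z≢y z≢x = Sum.swap (exact z cz z≢x z≢y)

  px : PendantsAt adj x y
  px = centre-pendants G c-edge cx exact apart

  py : PendantsAt adj y x
  py = centre-pendants G c-edge cy exact-swapped λ z w cz cw z≢y z≢x w≢y w≢x → apart z w cz cw z≢x z≢y w≢x w≢y

  ends : (x ≡ u × y ≡ v) ⊎ (x ≡ v × y ≡ u)
  ends with double-star-non-leaf G c-edge px py exact refl ¬lu
          | double-star-non-leaf G c-edge px py exact (same-class G c-edge refl uv) ¬lv
  ... | inj₁ refl | inj₁ refl = ⊥-elim (Adj⇒≢ G uv refl)
  ... | inj₁ refl | inj₂ refl = inj₁ (refl , refl)
  ... | inj₂ refl | inj₁ refl = inj₂ (refl , refl)
  ... | inj₂ refl | inj₂ refl = ⊥-elim (Adj⇒≢ G uv refl)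

  ends-swapped : (y ≡ u × x ≡ v) ⊎ (y ≡ v × x ≡ u)
  ends-swapped = Sum.swap (Sum.map Prod.swap Prod.swap ends)

corollary8p2 : (G : Graph) → 1 ≤ Graph.n G → NoIsolated (Graph.adj G) → (ERSupercritical G ⇔ UnionOfStarsAndDoubleStars G)
corollary8p2 G 1≤n no-isolated = mk⇔ (supercritical⇒union G 1≤n no-isolated) (union⇒supercritical G)
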